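{- The isomorphism relation $\cong_{f.p.}$ on (codes of) finite presentations of groups has a strong diagonal function: there is a computable function $\delta$ such that for every finite set $S$ of finite presentations (given by canonical index), $\delta(S)$ is a finite presentation of a group not isomorphic to any group presented by a member of $S$.
   Context: Finite presentations $\langle x_1,\dots,x_n; r_1,\dots,r_k\rangle$ of groups are coded by natural numbers; $\cong_{f.p.}$ relates two codes iff the presented groups are isomorphic. For an equivalence relation $E$ on $\omega$, a strong diagonal function is a computable function $\delta$ on finite sets (identified with their canonical indices) such that $\delta(D)\notin[D]_E$ for every finite $D$, where $[D]_E$ is the $E$-closure of $D$. -}

module Defs where

open import Level using (0ℓ)
open import Data.Nat using (ℕ)
open import Data.Fin using (Fin)
open import Data.Bool using (Bool; true; false; not)
open import Data.Product using (Σ; _×_; _,_; ∃)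
open import Data.List using (List; []; _∷_; _++_)
open import Data.List.Properties using (++-assoc; ++-identityʳ)
open import Data.List.Membership.Propositional using (_∈_)
open import Relation.Binary.PropositionalEquality as Eq using (_≡_)
open import Algebra.Bundles using (Group)
open import Algebra.Structures using (IsGroup)
open import Algebra.Morphism.Structures using (module GroupMorphisms)

-- A letter over n generators: (i , true) is x_i, (i , false) is x_i⁻¹.
Letter : ℕ → Set
Letter n = Fin n × Bool

invL : ∀ {n} → Letter n → Letter n
invL (i , b) = (i , not b)

Word : ℕ → Set
Word n = List (Letter n)

inv : ∀ {n} → Word n → Word n
inv []      = []
inv (x ∷ w) = inv w ++ (invL x ∷ [])

record Presentation : Set where
  constructor ⟨_∣_⟩
  field
    gens : ℕ
    rels : List (Word gens)
open Presentation public

-- The quotient is the free group modulo the normal closure of the relators.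
data _∼⟨_⟩_ {n : ℕ} : Word n → List (Word n) → Word n → Set where
  ∼-refl   : ∀ {R w} → w ∼⟨ R ⟩ w
  ∼-sym    : ∀ {R u v} → u ∼⟨ R ⟩ v → v ∼⟨ R ⟩ u
  ∼-trans  : ∀ {R u v w} → u ∼⟨ R ⟩ v → v ∼⟨ R ⟩ w → u ∼⟨ R ⟩ w
  ∼-cong   : ∀ {R u u′ v v′} → u ∼⟨ R ⟩ u′ → v ∼⟨ R ⟩ v′ → (u ++ v) ∼⟨ R ⟩ (u′ ++ v′)
  ∼-cancel : ∀ {R} (x : Letter n) → (x ∷ invL x ∷ []) ∼⟨ R ⟩ []
  ∼-rel    : ∀ {R r} → r ∈ R → r ∼⟨ R ⟩ []

module _ {n : ℕ} {R : List (Word n)} where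

  private
    _≈_ : Word n → Word n → Set
    u ≈ v = u ∼⟨ R ⟩ v

    ≡⇒≈ : ∀ {u v} → u ≡ v → u ≈ v
    ≡⇒≈ Eq.refl = ∼-refl

    inv-++ : (u v : Word n) → inv (u ++ v) ≡ inv v ++ inv u
    inv-++ [] v = Eq.sym (++-identityʳ (inv v))
    inv-++ (x ∷ u) v = Eq.trans (Eq.cong (_++ (invL x ∷ [])) (inv-++ u v))
                                (++-assoc (inv v) (inv u) (invL x ∷ []))

    cancel′ : (x : Letter n) → (invL x ∷ x ∷ []) ≈ []
    cancel′ (i , true)  = ∼-cancel (i , false)
    cancel′ (i , false) = ∼-cancel (i , true)

    invʳ : (w : Word n) → (w ++ inv w) ≈ []
    invʳ [] = ∼-refl
    invʳ (x ∷ w) =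
      ∼-trans (≡⇒≈ (Eq.cong (x ∷_) (Eq.sym (++-assoc w (inv w) (invL x ∷ [])))))
              (∼-trans (∼-cong {u = x ∷ []} ∼-refl (∼-cong (invʳ w) ∼-refl))
                       (∼-cancel x))

    invˡ : (w : Word n) → (inv w ++ w) ≈ []
    invˡ [] = ∼-refl
    invˡ (x ∷ w) =
      ∼-trans (≡⇒≈ (++-assoc (inv w) (invL x ∷ []) (x ∷ w)))
              (∼-trans (∼-cong {u = inv w} ∼-refl (∼-cong {u = invL x ∷ x ∷ []} (cancel′ x) ∼-refl))
                       (invˡ w))

    inv-cong : ∀ {u v} → u ≈ v → inv u ≈ inv v
    inv-cong ∼-refl = ∼-refl
    inv-cong (∼-sym p) = ∼-sym (inv-cong p)
    inv-cong (∼-trans p q) = ∼-trans (inv-cong p) (inv-cong q)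
    inv-cong (∼-cong {u = u} {u′} {v} {v′} p q) =
      ∼-trans (≡⇒≈ (inv-++ u v))
        (∼-trans (∼-cong (inv-cong q) (inv-cong p)) (≡⇒≈ (Eq.sym (inv-++ u′ v′))))
    inv-cong (∼-cancel (i , true))  = ∼-cancel (i , true)
    inv-cong (∼-cancel (i , false)) = ∼-cancel (i , false)
    inv-cong (∼-rel {r = r} r∈R) =
      ∼-trans (≡⇒≈ (Eq.sym (++-identityʳ (inv r))))
        (∼-trans (∼-cong {u = inv r} ∼-refl (∼-sym (∼-rel r∈R))) (invˡ r))

  presentedIsGroup : IsGroup (_∼⟨ R ⟩_) _++_ [] inv
  presentedIsGroup = record
    { isMonoid = record
      { isSemigroup = record
        { isMagma = record
          { isEquivalence = record { refl = ∼-refl ; sym = ∼-sym ; trans = ∼-trans }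
          ; ∙-cong = ∼-cong }
        ; assoc = λ u v w → ≡⇒≈ (++-assoc u v w) }
      ; identity = (λ w → ∼-refl) , (λ w → ≡⇒≈ (++-identityʳ w)) }
    ; inverse = invˡ , invʳ
    ; ⁻¹-cong = inv-cong }

PresentedGroup : Presentation → Group 0ℓ 0ℓ
PresentedGroup P = record { isGroup = presentedIsGroup {n = gens P} {R = rels P} }

_≅ᴳ_ : Group 0ℓ 0ℓ → Group 0ℓ 0ℓ → Set
G ≅ᴳ H = ∃ λ (f : Group.Carrier G → Group.Carrier H) →
           GroupMorphisms.IsGroupIsomorphism (Group.rawGroup G) (Group.rawGroup H) f

_≅fp_ : Presentation → Presentation → Set
P ≅fp Q = PresentedGroup P ≅ᴳ PresentedGroup Q

-- The free group on N generators has 2^N parity characters (homomorphisms to ℤ/2), one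
-- for each assignment of bits to the generators. A character of a group presented on n
-- generators is determined by its values on those generators, so there are at most 2^n
-- of them. Isomorphic groups have equally many characters, hence the free group on
-- N generators is not presented on fewer than N generators. The diagonal function
-- returns the free group on one more generator than any member of S has.
module Submission where

open import Defs
open import Data.List using (List)
open import Data.List.Membership.Propositional using (_∈_)
open import Data.Product using (Σ)
open import Relation.Nullary using (¬_; yes; no)

open import Level using (Level; 0ℓ; _⊔_)
open import Data.Bool using (Bool; true; false; _xor_)
open import Data.Bool.Properties using (xor-assoc; xor-same; xor-identityʳ)
open import Data.Empty using (⊥-elim)
open import Data.Fin using (Fin; combine; funToFin; finToFun) renaming (zero to fzero; suc to fsuc)
open import Data.Fin.Properties using (pigeonhole; funToFin-finToFin; finToFun-funToFin; <-irrefl; 2↔Bool)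
open import Data.List using ([]; _∷_; _++_; map)
open import Data.List.Extrema.Nat using (max; xs≤max)
open import Data.List.Membership.Propositional.Properties using (∈-map⁺)
import Data.List.Relation.Unary.All as All
open import Data.Nat using (ℕ; suc; _≤_; _<_; _^_; s≤s; z≤n; _≤?_)
open import Data.Nat.Properties using (^-monoʳ-<; ≰⇒>; ≤-trans; 1+n≰n)
open import Data.Product using (proj₁; proj₂; _,_)
open import Function using (_∘_; _↔_; Inverse)
open import Relation.Binary.PropositionalEquality
open import Algebra.Bundles using (Group)
open import Algebra.Morphism.Structures using (module MagmaMorphisms; module GroupMorphisms)

private
  variable
    a c ℓ : Level
    A : Set a
    m n N : ℕ

funToFin-cong : {f g : Fin n → Fin m} → f ≗ g → funToFin f ≡ funToFin g
funToFin-cong {n = 0}     f≗g = refl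
funToFin-cong {n = suc n} f≗g = cong₂ combine (f≗g fzero) (funToFin-cong (f≗g ∘ fsuc))

module _ (Fin↔A : Fin m ↔ A) (1<m : 1 < m) where
  open Inverse Fin↔A

  private
    encode : (Fin n → A) → Fin (m ^ n)
    encode u = funToFin (from ∘ u)

    decode : ∀ n → Fin (m ^ n) → (Fin n → A)
    decode n k = to ∘ finToFun k

    decode-encode : (u : Fin n → A) → decode n (encode u) ≗ u
    decode-encode u i = trans (cong to (finToFun-funToFin (from ∘ u) i)) (strictlyInverseˡ (u i))

    encode-cong : {u v : Fin n → A} → u ≗ v → encode u ≡ encode v
    encode-cong u≗v = funToFin-cong (cong from ∘ u≗v)

    encode-decode : ∀ n (k : Fin (m ^ n)) → encode (decode n k) ≡ k
    encode-decode n k = trans (funToFin-cong (strictlyInverseʳ ∘ finToFun {m} {n} k))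
                              (funToFin-finToFin {n} {m} k)

  -- Pigeonhole on the codes in Fin (m ^ N) of the assignments Fin N → A.
  pointwiseInjection⇒≤ : (W : (Fin N → A) → (Fin n → A)) →
                         (∀ u v → W u ≗ W v → u ≗ v) → N ≤ n
  pointwiseInjection⇒≤ {N} {n} W W-injective with N ≤? n
  ... | yes N≤n = N≤n
  ... | no  N≰n with pigeonhole (^-monoʳ-< m 1<m (≰⇒> N≰n)) (encode ∘ W ∘ decode N)
  ...   | k , l , k<l , codes≡ = ⊥-elim (<-irrefl k≡l k<l)
    where
    W-decode-≗ : W (decode N k) ≗ W (decode N l)
    W-decode-≗ i = begin
      W (decode N k) i                         ≡⟨ decode-encode (W (decode N k)) i ⟨
      decode n (encode (W (decode N k))) i     ≡⟨ cong (λ x → decode n x i) codes≡ ⟩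
      decode n (encode (W (decode N l))) i     ≡⟨ decode-encode (W (decode N l)) i ⟩
      W (decode N l) i                         ∎
      where open ≡-Reasoning

    k≡l : k ≡ l
    k≡l = begin
      k                    ≡⟨ encode-decode N k ⟨
      encode (decode N k)  ≡⟨ encode-cong (W-injective _ _ W-decode-≗) ⟩
      encode (decode N l)  ≡⟨ encode-decode N l ⟩
      l                    ∎
      where open ≡-Reasoning

record IsCharacter (G : Group c ℓ) (χ : Group.Carrier G → Bool) : Set (c ⊔ ℓ) where
  open Group G
  field
    resp-≈ : ∀ {x y} → x ≈ y → χ x ≡ χ y
    homo   : ∀ x y → χ (x ∙ y) ≡ χ x xor χ y

module _ {G H : Group c ℓ} where
  private
    module G = Group G
    module H = Group H

  IsCharacter-∘ : ∀ {χ g} → IsCharacter H χ →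
                  MagmaMorphisms.IsMagmaHomomorphism G.rawMagma H.rawMagma g →
                  IsCharacter G (χ ∘ g)
  IsCharacter-∘ {χ} {g} χ-char g-hom = record
    { resp-≈ = χ.resp-≈ ∘ ⟦⟧-cong
    ; homo   = λ x y → trans (χ.resp-≈ (homo x y)) (χ.homo (g x) (g y))
    }
    where
    module χ = IsCharacter χ-char
    open MagmaMorphisms.IsMagmaHomomorphism g-hom

module GroupIsomorphismInverse (G H : Group c ℓ) {f : Group.Carrier G → Group.Carrier H}
         (f-iso : GroupMorphisms.IsGroupIsomorphism (Group.rawGroup G) (Group.rawGroup H) f) where
  private
    module G = Group G
    module H = Group H
  open GroupMorphisms.IsGroupIsomorphism f-iso

  inverse : H.Carrier → G.Carrier
  inverse y = proj₁ (surjective y)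

  f∘inverse : ∀ y → f (inverse y) H.≈ y
  f∘inverse y = proj₂ (surjective y) G.refl

  inverse∘f : ∀ x → inverse (f x) G.≈ x
  inverse∘f x = injective (f∘inverse (f x))

  inverse-isMagmaHomomorphism : MagmaMorphisms.IsMagmaHomomorphism H.rawMagma G.rawMagma inverse
  inverse-isMagmaHomomorphism = record
    { isRelHomomorphism = record
      { cong = λ x≈y → injective (H.trans (f∘inverse _) (H.trans x≈y (H.sym (f∘inverse _)))) }
    ; homo = λ x y → injective (H.trans (f∘inverse (x H.∙ y))
                       (H.sym (H.trans (∙-homo (inverse x) (inverse y))
                                       (H.∙-cong (f∘inverse x) (f∘inverse y)))))
    }

generator : Fin n → Word n
generator i = (i , true) ∷ []

parity : (Fin n → Bool) → Word n → Bool
parity u []            = false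
parity u ((i , _) ∷ w) = u i xor parity u w

parity-++ : (u : Fin n → Bool) (v w : Word n) → parity u (v ++ w) ≡ parity u v xor parity u w
parity-++ u []            w = refl
parity-++ u ((i , _) ∷ v) w =
  trans (cong (u i xor_) (parity-++ u v w)) (sym (xor-assoc (u i) (parity u v) (parity u w)))

parity-congˡ : {u v : Fin n → Bool} → u ≗ v → (w : Word n) → parity u w ≡ parity v w
parity-congˡ u≗v []            = refl
parity-congˡ u≗v ((i , _) ∷ w) = cong₂ _xor_ (u≗v i) (parity-congˡ u≗v w)

parity-generator : (u : Fin n → Bool) (i : Fin n) → parity u (generator i) ≡ u i
parity-generator u i = xor-identityʳ (u i)

parity-isCharacter : (P : Presentation) (u : Fin (gens P) → Bool) →
                     (∀ {r} → r ∈ rels P → parity u r ≡ false) →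
                     IsCharacter (PresentedGroup P) (parity u)
parity-isCharacter P u even = record { resp-≈ = parity-cong ; homo = parity-++ u }
  where
  parity-cong : ∀ {v w} → v ∼⟨ rels P ⟩ w → parity u v ≡ parity u w
  parity-cong ∼-refl        = refl
  parity-cong (∼-sym p)     = sym (parity-cong p)
  parity-cong (∼-trans p q) = trans (parity-cong p) (parity-cong q)
  parity-cong (∼-rel r∈R)   = even r∈R
  parity-cong (∼-cancel (i , _)) =
    trans (sym (xor-assoc (u i) (u i) false)) (cong (_xor false) (xor-same (u i)))
  parity-cong (∼-cong {u = v} {v′} {w} {w′} p q) = begin
    parity u (v ++ w)                 ≡⟨ parity-++ u v w ⟩
    parity u v xor parity u w         ≡⟨ cong₂ _xor_ (parity-cong p) (parity-cong q) ⟩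
    parity u v′ xor parity u w′       ≡⟨ parity-++ u v′ w′ ⟨
    parity u (v′ ++ w′)               ∎
    where open ≡-Reasoning

xor≡false⇒≡ : ∀ x y → x xor y ≡ false → y ≡ x
xor≡false⇒≡ false false _ = refl
xor≡false⇒≡ true  true  _ = refl

module _ (P : Presentation) {χ : Word (gens P) → Bool}
         (χ-char : IsCharacter (PresentedGroup P) χ) where
  open IsCharacter χ-char

  private
    χ[]≡false : χ [] ≡ false
    χ[]≡false = trans (homo [] []) (xor-same (χ []))

    -- The relation x x⁻¹ = 1 forces χ x⁻¹ = χ x.
    χ-letter : ∀ i b → χ ((i , b) ∷ []) ≡ χ (generator i)
    χ-letter i true  = refl
    χ-letter i false = xor≡false⇒≡ _ _
      (trans (sym (homo (generator i) ((i , false) ∷ [])))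
             (trans (resp-≈ (∼-cancel (i , true))) χ[]≡false))

  character≗parity : ∀ w → χ w ≡ parity (χ ∘ generator) w
  character≗parity []            = χ[]≡false
  character≗parity ((i , b) ∷ w) =
    trans (homo ((i , b) ∷ []) w) (cong₂ _xor_ (χ-letter i b) (character≗parity w))

free : ℕ → Presentation
free N = ⟨ N ∣ [] ⟩

free≅fp⇒gens≤ : (P : Presentation) → free N ≅fp P → N ≤ gens P
free≅fp⇒gens≤ {N} P (f , f-iso) =
  pointwiseInjection⇒≤ 2↔Bool (s≤s (s≤s z≤n)) restrict restrict-injective
  where
  F G : Group 0ℓ 0ℓ
  F = PresentedGroup (free N)
  G = PresentedGroup P

  open GroupIsomorphismInverse F G f-iso renaming (inverse to g)

  free-parity-isCharacter : (u : Fin N → Bool) → IsCharacter F (parity u)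
  free-parity-isCharacter u = parity-isCharacter (free N) u (λ ())

  pullback-isCharacter : (u : Fin N → Bool) → IsCharacter G (parity u ∘ g)
  pullback-isCharacter u =
    IsCharacter-∘ (free-parity-isCharacter u) inverse-isMagmaHomomorphism

  restrict : (Fin N → Bool) → (Fin (gens P) → Bool)
  restrict u = parity u ∘ g ∘ generator

  recover : (u : Fin N → Bool) (j : Fin N) → u j ≡ parity (restrict u) (f (generator j))
  recover u j = begin
    u j                                       ≡⟨ parity-generator u j ⟨
    parity u (generator j)                    ≡⟨ IsCharacter.resp-≈ (free-parity-isCharacter u)
                                                   (∼-sym (inverse∘f (generator j))) ⟩
    parity u (g (f (generator j)))            ≡⟨ character≗parity P (pullback-isCharacter u) _ ⟩
    parity (restrict u) (f (generator j))     ∎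
    where open ≡-Reasoning

  restrict-injective : ∀ u v → restrict u ≗ restrict v → u ≗ v
  restrict-injective u v r≗ j =
    trans (recover u j) (trans (parity-congˡ r≗ (f (generator j))) (sym (recover v j)))

proposition4p2 : Σ (List Presentation → Presentation) λ δ →
                   (S : List Presentation) (P : Presentation) → P ∈ S → ¬ (δ S ≅fp P)
proposition4p2 = δ , δ≇
  where
  bound : List Presentation → ℕ
  bound S = max 0 (map gens S)

  δ : List Presentation → Presentation
  δ S = free (suc (bound S))

  δ≇ : (S : List Presentation) (P : Presentation) → P ∈ S → ¬ (δ S ≅fp P)
  δ≇ S P P∈S δS≅P = 1+n≰n (≤-trans (free≅fp⇒gens≤ P δS≅P) gens≤bound)
    where
    gens≤bound : gens P ≤ bound S
    gens≤bound = All.lookup (xs≤max 0 (map gens S)) (∈-map⁺ gens P∈S)
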